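{- For every integer $d\ge 3$, the independence number of the Keller graph satisfies $\alpha(G_d)=2^d$; moreover $\alpha(G_2)=5$.
   Context: The Keller graph $G_d$ has as vertices the $4^d$ tuples in $\{0,1,2,3\}^d$; two tuples $u,v$ are adjacent iff they differ in at least two coordinates and there is at least one coordinate $i$ with $u_i-v_i\equiv 2\pmod 4$. $\alpha$ denotes the maximum size of an independent set. -}

module Defs where

open import Data.Nat using (ℕ; _≤_; _+_)
open import Data.Fin using (Fin; toℕ)
open import Data.Vec using (Vec; lookup; tabulate; allFin; count)
open import Data.List using (List; length)
open import Data.List.Relation.Unary.All using (All)
open import Data.List.Relation.Unary.Unique.Propositional using (Unique)
open import Data.List.Membership.Propositional using (_∈_)
open import Data.Product using (Σ; ∃; _×_)
open import Relation.Binary.PropositionalEquality using (_≡_; _≢_)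
open import Relation.Nullary using (¬_)
open import Data.Fin.Properties using (_≟_)
open import Relation.Nullary.Decidable using (¬?)

Vertex : ℕ → Set
Vertex d = Vec (Fin 4) d

-- "u_i - v_i ≡ 2 (mod 4)" for values in {0,1,2,3}: equivalently u_i + 2 ≡ v_i (mod 4),
-- i.e. (toℕ u_i + 2) mod 4 = toℕ v_i.  We state it via addition mod 4.
open import Data.Nat.DivMod using (_%_)

DiffTwo : Fin 4 → Fin 4 → Set
DiffTwo a b = (toℕ a + 2) % 4 ≡ toℕ b

numDiff : ∀ {d} → Vertex d → Vertex d → ℕ
numDiff {d} u v = count (λ i → ¬? (lookup u i ≟ lookup v i)) (allFin d)

Adjacent : ∀ {d} → Vertex d → Vertex d → Set
Adjacent {d} u v = (2 ≤ numDiff u v) × ∃ (λ (i : Fin d) → DiffTwo (lookup u i) (lookup v i))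

IsIndependent : ∀ {d} → List (Vertex d) → Set
IsIndependent {d} S = Unique S × (∀ {u v} → u ∈ S → v ∈ S → ¬ Adjacent u v)

IndependenceNumber : ℕ → ℕ → Set
IndependenceNumber d n =
  Σ (List (Vertex d)) (λ S → IsIndependent S × length S ≡ n)
  × (∀ (S : List (Vertex d)) → IsIndependent S → length S ≤ n)

module Submission where

-- Reduce coordinates mod 2. If two vertices u, u′ of an independent set T have the same parity
-- vector, they differ by 2 in some coordinate i and, being non-adjacent, nowhere else; then no
-- third vertex of T has the parity of u at i. Restrict T to a partial assignment C of parities:
-- either parities are injective on the restriction (at most 2^free C vertices), or a twin pair
-- appears in a fixed coordinate (at most 2 vertices), or in a free one, and fixing that coordinate
-- to the opposite parity loses only the pair. After one such split some vertex of T violates C,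
-- after two every fixed value is attained outside the restriction, which rules out twins in a fixed
-- coordinate. Hence α(G_d) ≤ max(2^d, 2^(d-1) + d + 1), which is 2^d for d ≥ 3 and 5 for d = 2.
-- The {0,1}-vectors are independent since no two coordinates differ by 2.

open import Defs
open import Data.Bool using (Bool; true; false; not)
import Data.Bool.Properties as Bool
open import Data.Empty using (⊥-elim)
open import Data.Fin using (Fin; zero; suc; toℕ)
open import Data.Fin.Patterns using (0F; 1F; 2F; 3F)
open import Data.Fin.Properties using (_≟_; toℕ-injective; ¬∀⟶∃¬)
import Data.Fin.Properties as Fin
open import Data.List as List using (List; []; _∷_; [_]; length; filter; _++_)
open import Data.List.Membership.Propositional using (_∈_; find; _─_)
open import Data.List.Membership.Propositional.Properties
  using (∈-map⁺; ∈-map⁻; ∈-++⁺ˡ; ∈-++⁺ʳ; ∈-filter⁺; ∈-filter⁻)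
open import Data.List.Properties using (length-map; length-++; length-removeAt′)
open import Data.List.Relation.Binary.Subset.Propositional using (_⊆_)
import Data.List.Relation.Unary.All as All
import Data.List.Relation.Unary.All.Properties as All
open import Data.List.Relation.Unary.AllPairs using (allPairs?; []; _∷_)
open import Data.List.Relation.Unary.Any using (here; there; any?; index)
open import Data.List.Relation.Unary.Unique.Propositional using (Unique)
import Data.List.Relation.Unary.Unique.Propositional.Properties as Unique
open import Data.Maybe using (Maybe; just; nothing)
open import Data.Maybe.Properties using (just-injective)
import Data.Maybe.Relation.Unary.All as Maybe
open import Data.Nat as ℕ using (ℕ; zero; suc; _≤_; _≤?_; _+_; _^_; _⊔_; z≤n; s≤s)
open import Data.Nat.DivMod using (_%_)
open import Data.Nat.Properties
  using (≤-refl; ≤-trans; ≤-reflexive; m≤m+n; m≤n⇒m≤1+n; +-suc; +-identityʳ; +-mono-≤; +-monoˡ-≤;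
         +-monoʳ-≤; *-monoʳ-≤; m^n>0; m≤m⊔n; m≤n⊔m; ⊔-lub; suc-injective; 0≢1+n; module ≤-Reasoning)
open import Data.Product using (∃; ∃₂; _×_; _,_; proj₁; proj₂)
open import Data.Sum using (_⊎_; inj₁; inj₂)
open import Data.Vec as Vec using (Vec; []; _∷_; lookup; replicate; allFin; count; _[_]≔_)
open import Data.Vec.Properties
  using (tabulate∘lookup; tabulate-cong; lookup-map; lookup-allFin; lookup-replicate;
         lookup∘update; lookup∘update′; ∷-injectiveʳ; ≡-dec; map-∘; map-cong; map-id)
open import Function using (_∘_)
open import Relation.Binary.Definitions using (DecidableEquality)
open import Relation.Binary.PropositionalEquality 
  using (_≡_; _≢_; refl; sym; trans; cong; cong₂; subst; subst₂; module ≡-Reasoning)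
open import Relation.Nullary using (¬_; Dec; yes; no; contradiction)
open import Relation.Nullary.Decidable using (¬?; _×-dec_; decidable-stable; from-yes; map′)
open import Relation.Unary using (Pred; Decidable)

parity : Fin 4 → Bool
parity 0F = false
parity 1F = true
parity 2F = false
parity 3F = true

antipode : Fin 4 → Fin 4
antipode 0F = 2F
antipode 1F = 3F
antipode 2F = 0F
antipode 3F = 1F

antipode-involutive : ∀ a → antipode (antipode a) ≡ a
antipode-involutive 0F = refl
antipode-involutive 1F = refl
antipode-involutive 2F = refl
antipode-involutive 3F = refl

antipode-≢ : ∀ a → antipode a ≢ a
antipode-≢ 0F ()
antipode-≢ 1F ()
antipode-≢ 2F ()
antipode-≢ 3F ()

DiffTwo⇒antipode : ∀ {a b} → DiffTwo a b → antipode a ≡ b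
DiffTwo⇒antipode {0F} eq = toℕ-injective eq
DiffTwo⇒antipode {1F} eq = toℕ-injective eq
DiffTwo⇒antipode {2F} eq = toℕ-injective eq
DiffTwo⇒antipode {3F} eq = toℕ-injective eq

antipode⇒DiffTwo : ∀ {a b} → antipode a ≡ b → DiffTwo a b
antipode⇒DiffTwo {0F} refl = refl
antipode⇒DiffTwo {1F} refl = refl
antipode⇒DiffTwo {2F} refl = refl
antipode⇒DiffTwo {3F} refl = refl

same-parity⇒≡⊎antipode : ∀ {a b} → parity a ≡ parity b → a ≡ b ⊎ antipode a ≡ b
same-parity⇒≡⊎antipode {0F} {0F} _ = inj₁ refl
same-parity⇒≡⊎antipode {0F} {2F} _ = inj₂ refl
same-parity⇒≡⊎antipode {1F} {1F} _ = inj₁ refl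
same-parity⇒≡⊎antipode {1F} {3F} _ = inj₂ refl
same-parity⇒≡⊎antipode {2F} {0F} _ = inj₂ refl
same-parity⇒≡⊎antipode {2F} {2F} _ = inj₁ refl
same-parity⇒≡⊎antipode {3F} {1F} _ = inj₂ refl
same-parity⇒≡⊎antipode {3F} {3F} _ = inj₁ refl
same-parity⇒≡⊎antipode {0F} {1F} ()
same-parity⇒≡⊎antipode {0F} {3F} ()
same-parity⇒≡⊎antipode {1F} {0F} ()
same-parity⇒≡⊎antipode {1F} {2F} ()
same-parity⇒≡⊎antipode {2F} {1F} ()
same-parity⇒≡⊎antipode {2F} {3F} ()
same-parity⇒≡⊎antipode {3F} {0F} ()
same-parity⇒≡⊎antipode {3F} {2F} ()

bit : Bool → Fin 4
bit false = 0F
bit true  = 1F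

parity-bit : ∀ b → parity (bit b) ≡ b
parity-bit false = refl
parity-bit true  = refl

antipode-bit≢bit : ∀ b c → antipode (bit b) ≢ bit c
antipode-bit≢bit false false ()
antipode-bit≢bit false true  ()
antipode-bit≢bit true  false ()
antipode-bit≢bit true  true  ()

module _ {a p} {A : Set a} {P : Pred A p} (P? : Decidable P) where

  count-pos : ∀ {n} (xs : Vec A n) i → P (lookup xs i) → 1 ≤ count P? xs
  count-pos (x ∷ xs) i       pxᵢ with P? x
  count-pos (x ∷ xs) i       pxᵢ | yes _  = s≤s z≤n
  count-pos (x ∷ xs) zero    px  | no ¬px = contradiction px ¬px
  count-pos (x ∷ xs) (suc i) pxᵢ | no _   = count-pos xs i pxᵢ

  count-two : ∀ {n} (xs : Vec A n) {i j} → i ≢ j → P (lookup xs i) → P (lookup xs j) → 2 ≤ count P? xs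
  count-two (x ∷ xs) {zero}  {zero}  i≢j _ _ = contradiction refl i≢j
  count-two (x ∷ xs) {zero}  {suc j} _ px pxⱼ with P? x
  ... | yes _  = s≤s (count-pos xs j pxⱼ)
  ... | no ¬px = contradiction px ¬px
  count-two (x ∷ xs) {suc i} {zero}  _ pxᵢ px with P? x
  ... | yes _  = s≤s (count-pos xs i pxᵢ)
  ... | no ¬px = contradiction px ¬px
  count-two (x ∷ xs) {suc i} {suc j} i≢j pxᵢ pxⱼ with P? x
  ... | yes _ = m≤n⇒m≤1+n (count-two xs (i≢j ∘ cong suc) pxᵢ pxⱼ)
  ... | no _  = count-two xs (i≢j ∘ cong suc) pxᵢ pxⱼ

lookup-ext : ∀ {a} {A : Set a} {n} {u v : Vec A n} → (∀ i → lookup u i ≡ lookup v i) → u ≡ v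
lookup-ext {u = u} {v} eq = trans (sym (tabulate∘lookup u)) (trans (tabulate-cong eq) (tabulate∘lookup v))

≢⇒differ-at : ∀ {d} {u v : Vertex d} → u ≢ v → ∃ λ i → lookup u i ≢ lookup v i
≢⇒differ-at {d} {u} {v} u≢v = ¬∀⟶∃¬ d _ (λ i → lookup u i ≟ lookup v i) (u≢v ∘ lookup-ext)

nonadjacent-antipodal⇒agree : ∀ {d} {u v : Vertex d} {i} → ¬ Adjacent u v →
  antipode (lookup u i) ≡ lookup v i → ∀ j → j ≢ i → lookup u j ≡ lookup v j
nonadjacent-antipodal⇒agree {d} {u} {v} {i} ¬adj antipodal j j≢i =
  decidable-stable (lookup u j ≟ lookup v j) λ uⱼ≢vⱼ →
    ¬adj (count-two differ? (allFin d) j≢i (via-allFin j uⱼ≢vⱼ) (via-allFin i uᵢ≢vᵢ) , i , antipode⇒DiffTwo antipodal)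
  where
  differ? = λ k → ¬? (lookup u k ≟ lookup v k)
  via-allFin : ∀ k → lookup u k ≢ lookup v k → lookup u (lookup (allFin d) k) ≢ lookup v (lookup (allFin d) k)
  via-allFin k = subst (λ m → lookup u m ≢ lookup v m) (sym (lookup-allFin k))
  uᵢ≢vᵢ : lookup u i ≢ lookup v i
  uᵢ≢vᵢ uᵢ≡vᵢ = antipode-≢ (lookup u i) (trans antipodal (sym uᵢ≡vᵢ))

module _ {d} {T : List (Vertex d)} (indep : IsIndependent T) where

  private
    agree-off : ∀ {u v i} → u ∈ T → v ∈ T → antipode (lookup u i) ≡ lookup v i →
                ∀ j → j ≢ i → lookup u j ≡ lookup v j
    agree-off {u} {v} u∈T v∈T = nonadjacent-antipodal⇒agree {u = u} {v} (proj₂ indep u∈T v∈T)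

    determined-at : ∀ {u u′ w i} → u ∈ T → u′ ∈ T → w ∈ T →
                    antipode (lookup u i) ≡ lookup u′ i → lookup w i ≡ lookup u i → w ≡ u
    determined-at {u} {u′} {w} {i} u∈T u′∈T w∈T u↦u′ wᵢ≡uᵢ = lookup-ext agree
      where
      w↦u′ : antipode (lookup w i) ≡ lookup u′ i
      w↦u′ = trans (cong antipode wᵢ≡uᵢ) u↦u′
      agree : ∀ j → lookup w j ≡ lookup u j
      agree j with j ≟ i
      ... | yes refl = wᵢ≡uᵢ
      ... | no j≢i   = trans (agree-off w∈T u′∈T w↦u′ j j≢i) (sym (agree-off u∈T u′∈T u↦u′ j j≢i))

  -- Equal parity vectors force a difference of 2 at some i, so non-adjacency leaves i as the only
  -- difference; a third vertex with the same parity at i would be at difference 0 or 2 from both.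
  twin-direction : ∀ {u u′} → u ∈ T → u′ ∈ T → u ≢ u′ → Vec.map parity u ≡ Vec.map parity u′ →
    ∃ λ i → ∀ {w} → w ∈ T → parity (lookup w i) ≡ parity (lookup u i) → w ≡ u ⊎ w ≡ u′
  twin-direction {u} {u′} u∈T u′∈T u≢u′ same with ≢⇒differ-at u≢u′
  ... | i , uᵢ≢u′ᵢ = i , twins
    where
    parity-at : ∀ j → parity (lookup u j) ≡ parity (lookup u′ j)
    parity-at j = trans (sym (lookup-map j parity u)) (trans (cong (λ p → lookup p j) same) (lookup-map j parity u′))
    u↦u′ : antipode (lookup u i) ≡ lookup u′ i
    u↦u′ with same-parity⇒≡⊎antipode (parity-at i)
    ... | inj₁ uᵢ≡u′ᵢ = contradiction uᵢ≡u′ᵢ uᵢ≢u′ᵢ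
    ... | inj₂ u↦u′   = u↦u′
    u′↦u : antipode (lookup u′ i) ≡ lookup u i
    u′↦u = trans (cong antipode (sym u↦u′)) (antipode-involutive (lookup u i))
    twins : ∀ {w} → w ∈ T → parity (lookup w i) ≡ parity (lookup u i) → w ≡ u ⊎ w ≡ u′
    twins w∈T same-at-i with same-parity⇒≡⊎antipode (sym same-at-i)
    ... | inj₁ uᵢ≡wᵢ = inj₁ (determined-at u∈T u′∈T w∈T u↦u′ (sym uᵢ≡wᵢ))
    ... | inj₂ u↦w   = inj₂ (determined-at u′∈T u∈T w∈T u′↦u (trans (sym u↦w) u↦u′))

module _ {a} {A : Set a} where

  ∈-─ : ∀ {x y} {ys : List A} (x∈ys : x ∈ ys) → y ∈ ys → y ≢ x → y ∈ ys ─ x∈ys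
  ∈-─ (here refl) (here refl) y≢x = contradiction refl y≢x
  ∈-─ (here _)    (there y∈ys) _   = y∈ys
  ∈-─ (there _)   (here y≡z)   _   = here y≡z
  ∈-─ (there x∈ys) (there y∈ys) y≢x = there (∈-─ x∈ys y∈ys y≢x)

  Unique-⊆⇒length≤ : ∀ {xs ys : List A} → Unique xs → xs ⊆ ys → length xs ≤ length ys
  Unique-⊆⇒length≤ {[]}     _                 _     = z≤n
  Unique-⊆⇒length≤ {x ∷ xs} {ys} (x∉xs ∷ uniq) xs⊆ys = begin
    suc (length xs)           ≤⟨ s≤s (Unique-⊆⇒length≤ uniq xs⊆ys─x) ⟩
    suc (length (ys ─ x∈ys))  ≡⟨ sym (length-removeAt′ ys (index x∈ys)) ⟩
    length ys                 ∎
    where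
    open ≤-Reasoning
    x∈ys = xs⊆ys (here refl)
    xs⊆ys─x : xs ⊆ ys ─ x∈ys
    xs⊆ys─x z∈xs = ∈-─ x∈ys (xs⊆ys (there z∈xs)) (λ z≡x → All.lookup x∉xs z∈xs (sym z≡x))

module _ {a b} {A : Set a} {B : Set b} (_≟ᴮ_ : DecidableEquality B) (f : A → B) where

  Unique-map⊎collision : ∀ {xs} → Unique xs →
    Unique (List.map f xs) ⊎ ∃₂ λ x y → x ∈ xs × y ∈ xs × x ≢ y × f x ≡ f y
  Unique-map⊎collision {[]}     _ = inj₁ []
  Unique-map⊎collision {x ∷ xs} (x∉xs ∷ uniq) with any? (λ y → f x ≟ᴮ f y) xs
  ... | yes fx∈fxs = let y , y∈xs , fx≡fy = find fx∈fxs in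
                     inj₂ (x , y , here refl , there y∈xs , All.lookup x∉xs y∈xs , fx≡fy)
  ... | no  fx∉fxs with Unique-map⊎collision uniq
  ...   | inj₁ uniq-f = inj₁ (All.map⁺ (All.¬Any⇒All¬ xs fx∉fxs) ∷ uniq-f)
  ...   | inj₂ (y , z , y∈ , z∈ , y≢z , fy≡fz) = inj₂ (y , z , there y∈ , there z∈ , y≢z , fy≡fz)

Constraint : ℕ → Set
Constraint = Vec (Maybe Bool)

infix 4 _⊨_ _⊨?_

record _⊨_ {d} (C : Constraint d) (w : Vertex d) : Set where
  constructor satisfies
  field
    at : ∀ j → Maybe.All (parity (lookup w j) ≡_) (lookup C j)

open _⊨_

_⊨?_ : ∀ {d} (C : Constraint d) → Decidable (C ⊨_)
C ⊨? w = map′ satisfies at (Fin.all? λ j → Maybe.dec (parity (lookup w j) Bool.≟_) (lookup C j))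

free : ∀ {d} → Constraint d → ℕ
free []            = 0
free (nothing ∷ C) = suc (free C)
free (just _ ∷ C)  = free C

unconstrained : ∀ d → Constraint d
unconstrained d = replicate d nothing

free-unconstrained : ∀ d → free (unconstrained d) ≡ d
free-unconstrained zero    = refl
free-unconstrained (suc d) = cong suc (free-unconstrained d)

free-[]≔ : ∀ {d} (C : Constraint d) i b → lookup C i ≡ nothing → free C ≡ suc (free (C [ i ]≔ just b))
free-[]≔ (nothing ∷ C) zero    b _    = refl
free-[]≔ (nothing ∷ C) (suc i) b Cᵢ≡- = cong suc (free-[]≔ C i b Cᵢ≡-)
free-[]≔ (just _ ∷ C)  (suc i) b Cᵢ≡- = free-[]≔ C i b Cᵢ≡-

⊨-unconstrained : ∀ {d} {w : Vertex d} → unconstrained d ⊨ w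
⊨-unconstrained = satisfies λ j → subst (Maybe.All _) (sym (lookup-replicate j nothing)) Maybe.nothing

module _ {d} {C : Constraint d} {w : Vertex d} where

  ⊨-just : ∀ {j b} → C ⊨ w → lookup C j ≡ just b → parity (lookup w j) ≡ b
  ⊨-just {j} C⊨w Cⱼ≡b = Maybe.drop-just (subst (Maybe.All _) Cⱼ≡b (at C⊨w j))

  ⊨-[]≔⁺ : ∀ {i b} → C ⊨ w → parity (lookup w i) ≡ b → C [ i ]≔ just b ⊨ w
  ⊨-[]≔⁺ {i} {b} C⊨w wᵢ≡b = satisfies at′
    where
    at′ : ∀ j → Maybe.All (parity (lookup w j) ≡_) (lookup (C [ i ]≔ just b) j)
    at′ j with j ≟ i
    ... | yes refl = subst (Maybe.All _) (sym (lookup∘update i C (just b))) (Maybe.just wᵢ≡b)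
    ... | no j≢i   = subst (Maybe.All _) (sym (lookup∘update′ j≢i C (just b))) (at C⊨w j)

  ⊨-[]≔⁻ : ∀ {i b} → lookup C i ≡ nothing → C [ i ]≔ just b ⊨ w → C ⊨ w
  ⊨-[]≔⁻ {i} {b} Cᵢ≡- C′⊨w = satisfies at′
    where
    at′ : ∀ j → Maybe.All (parity (lookup w j) ≡_) (lookup C j)
    at′ j with j ≟ i
    ... | yes refl = subst (Maybe.All _) (sym Cᵢ≡-) Maybe.nothing
    ... | no j≢i   = subst (Maybe.All _) (lookup∘update′ j≢i C (just b)) (at C′⊨w j)

completions : ∀ {d} → Constraint d → List (Vec Bool d)
completions []            = [ [] ]
completions (nothing ∷ C) = List.map (false ∷_) (completions C) ++ List.map (true ∷_) (completions C)
completions (just b ∷ C)  = List.map (b ∷_) (completions C)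

length-completions : ∀ {d} (C : Constraint d) → length (completions C) ≡ 2 ^ free C
length-completions []            = refl
length-completions (nothing ∷ C) = begin
  length (List.map (false ∷_) cs ++ List.map (true ∷_) cs)         ≡⟨ length-++ (List.map (false ∷_) cs) ⟩
  length (List.map (false ∷_) cs) + length (List.map (true ∷_) cs) ≡⟨ cong₂ _+_ (length-map _ cs) (length-map _ cs) ⟩
  length cs + length cs                                             ≡⟨ cong (λ n → n + n) (length-completions C) ⟩
  2 ^ free C + 2 ^ free C                                           ≡⟨ cong (2 ^ free C +_) (sym (+-identityʳ _)) ⟩
  2 ^ suc (free C)                                                  ∎
  where
  open ≡-Reasoning
  cs = completions C
length-completions (just b ∷ C)  = trans (length-map _ (completions C)) (length-completions C)

parities∈completions : ∀ {d} (C : Constraint d) {w} → C ⊨ w → Vec.map parity w ∈ completions C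
parities∈completions []            {[]}    _   = here refl
parities∈completions (nothing ∷ C) {x ∷ w} C⊨w with parity x
... | false = ∈-++⁺ˡ (∈-map⁺ _ (parities∈completions C (satisfies (at C⊨w ∘ suc))))
... | true  = ∈-++⁺ʳ _ (∈-map⁺ _ (parities∈completions C (satisfies (at C⊨w ∘ suc))))
parities∈completions (just b ∷ C)  {x ∷ w} C⊨w with at C⊨w zero
... | Maybe.just refl = ∈-map⁺ _ (parities∈completions C (satisfies (at C⊨w ∘ suc)))

Unique-completions : ∀ {d} (C : Constraint d) → Unique (completions C)
Unique-completions []            = All.[] ∷ []
Unique-completions (nothing ∷ C) =
  Unique.++⁺ (Unique.map⁺ ∷-injectiveʳ (Unique-completions C)) (Unique.map⁺ ∷-injectiveʳ (Unique-completions C))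
    disjoint
  where
  disjoint : ∀ {v} → ¬ (v ∈ List.map (false ∷_) (completions C) × v ∈ List.map (true ∷_) (completions C))
  disjoint (v∈₀ , v∈₁) with ∈-map⁻ (false ∷_) v∈₀ | ∈-map⁻ (true ∷_) v∈₁
  ... | _ , _ , refl | _ , _ , ()
Unique-completions (just b ∷ C)  = Unique.map⁺ ∷-injectiveʳ (Unique-completions C)

2≤2^[1+n] : ∀ n → 2 ≤ 2 ^ suc n
2≤2^[1+n] n = *-monoʳ-≤ 2 (m^n>0 2 n)

2^n+2^n≡2^[1+n] : ∀ n → 2 ^ n + 2 ^ n ≡ 2 ^ suc n
2^n+2^n≡2^[1+n] n = cong (2 ^ n +_) (sym (+-identityʳ (2 ^ n)))

2+[2^n+n]≤2^[1+n]+[1+n] : ∀ n → 2 + (2 ^ n + n) ≤ 2 ^ suc n + suc n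
2+[2^n+n]≤2^[1+n]+[1+n] n = begin
  2 + (2 ^ n + n)         ≡⟨ cong suc (sym (+-suc (2 ^ n) n)) ⟩
  1 + 2 ^ n + suc n       ≤⟨ +-monoˡ-≤ (suc n) (+-monoˡ-≤ (2 ^ n) (m^n>0 2 n)) ⟩
  2 ^ n + 2 ^ n + suc n   ≡⟨ cong (_+ suc n) (2^n+2^n≡2^[1+n] n) ⟩
  2 ^ suc n + suc n       ∎
  where open ≤-Reasoning

4+n≤2^[2+n] : ∀ n → 4 + n ≤ 2 ^ (2 + n)
4+n≤2^[2+n] zero    = ≤-refl
4+n≤2^[2+n] (suc n) = begin
  1 + (4 + n)                 ≤⟨ +-mono-≤ (m^n>0 2 (2 + n)) (4+n≤2^[2+n] n) ⟩
  2 ^ (2 + n) + 2 ^ (2 + n)   ≡⟨ 2^n+2^n≡2^[1+n] (2 + n) ⟩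
  2 ^ (3 + n)                 ∎
  where open ≤-Reasoning

2+[2^[2+n]+[2+n]]≤2^[3+n] : ∀ n → 2 + (2 ^ (2 + n) + (2 + n)) ≤ 2 ^ (3 + n)
2+[2^[2+n]+[2+n]]≤2^[3+n] n = begin
  2 + (2 ^ (2 + n) + (2 + n))   ≡⟨ cong suc (sym (+-suc (2 ^ (2 + n)) (2 + n))) ⟩
  1 + (2 ^ (2 + n) + (3 + n))   ≡⟨ sym (+-suc (2 ^ (2 + n)) (3 + n)) ⟩
  2 ^ (2 + n) + (4 + n)         ≤⟨ +-monoʳ-≤ (2 ^ (2 + n)) (4+n≤2^[2+n] n) ⟩
  2 ^ (2 + n) + 2 ^ (2 + n)     ≡⟨ 2^n+2^n≡2^[1+n] (2 + n) ⟩
  2 ^ (3 + n)                   ∎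
  where open ≤-Reasoning

module Refinement {d} {T : List (Vertex d)} (indep : IsIndependent T) where

  restrict : Constraint d → List (Vertex d)
  restrict C = filter (C ⊨?_) T

  Unique-restrict : ∀ C → Unique (restrict C)
  Unique-restrict C = Unique.filter⁺ (C ⊨?_) (proj₁ indep)

  ∈-restrict⁻ : ∀ {C w} → w ∈ restrict C → w ∈ T × C ⊨ w
  ∈-restrict⁻ {C} = ∈-filter⁻ (C ⊨?_) {xs = T}

  ∈-restrict⁺ : ∀ {C w} → w ∈ T → C ⊨ w → w ∈ restrict C
  ∈-restrict⁺ {C} = ∈-filter⁺ (C ⊨?_) {xs = T}

  Escapes : Constraint d → Set
  Escapes C = ∃ λ z → z ∈ T × ¬ C ⊨ z

  Witnessed : Constraint d → Set
  Witnessed C = ∀ {j b} → lookup C j ≡ just b → ∃ λ z → z ∈ T × ¬ C ⊨ z × parity (lookup z j) ≡ b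

  record Twins (C : Constraint d) : Set where
    field
      u u′       : Vertex d
      u∈T        : u ∈ T
      u⊨C        : C ⊨ u
      u′⊨C       : C ⊨ u′
      direction  : Fin d
      only-twins : ∀ {w} → w ∈ T → parity (lookup w direction) ≡ parity (lookup u direction) →
                   w ≡ u ⊎ w ≡ u′

  Unique-parities⊎Twins : ∀ C → Unique (List.map (Vec.map parity) (restrict C)) ⊎ Twins C
  Unique-parities⊎Twins C
    with Unique-map⊎collision (≡-dec Bool._≟_) (Vec.map parity) (Unique-restrict C)
  ... | inj₁ uniq = inj₁ uniq
  ... | inj₂ (u , u′ , u∈ , u′∈ , u≢u′ , same) =
    let u∈T , u⊨C   = ∈-restrict⁻ u∈
        u′∈T , u′⊨C = ∈-restrict⁻ u′∈
        i , only    = twin-direction indep u∈T u′∈T u≢u′ same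
    in inj₂ (record { u = u ; u′ = u′ ; u∈T = u∈T ; u⊨C = u⊨C ; u′⊨C = u′⊨C
                    ; direction = i ; only-twins = only })

  length-restrict≤2^free : ∀ C → Unique (List.map (Vec.map parity) (restrict C)) →
                           length (restrict C) ≤ 2 ^ free C
  length-restrict≤2^free C uniq = begin
    length (restrict C)                             ≡⟨ sym (length-map _ (restrict C)) ⟩
    length (List.map (Vec.map parity) (restrict C)) ≤⟨ Unique-⊆⇒length≤ uniq parities⊆completions ⟩
    length (completions C)                          ≡⟨ length-completions C ⟩
    2 ^ free C                                      ∎
    where
    open ≤-Reasoning
    parities⊆completions : List.map (Vec.map parity) (restrict C) ⊆ completions C
    parities⊆completions p∈ with ∈-map⁻ _ p∈
    ... | w , w∈ , refl = parities∈completions C (proj₂ (∈-restrict⁻ w∈))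

  module _ {C : Constraint d} (twins : Twins C) where

    open Twins twins

    private
      i  = direction
      b′ = not (parity (lookup u i))
      C′ = C [ i ]≔ just b′

      ≡-twin⇒∈ : ∀ {w xs} → w ≡ u ⊎ w ≡ u′ → w ∈ u ∷ u′ ∷ xs
      ≡-twin⇒∈ (inj₁ w≡u)  = here w≡u
      ≡-twin⇒∈ (inj₂ w≡u′) = there (here w≡u′)

      twin⇒⊨ : ∀ {w} → w ≡ u ⊎ w ≡ u′ → C ⊨ w
      twin⇒⊨ (inj₁ refl) = u⊨C
      twin⇒⊨ (inj₂ refl) = u′⊨C

    pinned-length≤2 : ∀ {b} → lookup C i ≡ just b → length (restrict C) ≤ 2
    pinned-length≤2 Cᵢ≡b = Unique-⊆⇒length≤ {ys = u ∷ u′ ∷ []} (Unique-restrict C) λ w∈ →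
      let w∈T , w⊨C = ∈-restrict⁻ w∈ in
      ≡-twin⇒∈ (only-twins w∈T (trans (⊨-just w⊨C Cᵢ≡b) (sym (⊨-just u⊨C Cᵢ≡b))))

    pinned-¬Witnessed : ∀ {b} → lookup C i ≡ just b → ¬ Witnessed C
    pinned-¬Witnessed Cᵢ≡b witnessed =
      let z , z∈T , z⊭C , zᵢ≡b = witnessed Cᵢ≡b in
      z⊭C (twin⇒⊨ (only-twins z∈T (trans zᵢ≡b (sym (⊨-just u⊨C Cᵢ≡b)))))

    module _ (Cᵢ≡- : lookup C i ≡ nothing) where

      split-free : free C ≡ suc (free C′)
      split-free = free-[]≔ C i b′ Cᵢ≡-

      split-length : length (restrict C) ≤ 2 + length (restrict C′)
      split-length = Unique-⊆⇒length≤ (Unique-restrict C) λ {w} w∈ →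
        let w∈T , w⊨C = ∈-restrict⁻ w∈ in
        classify w∈T w⊨C (parity (lookup w i) Bool.≟ parity (lookup u i))
        where
        classify : ∀ {w} → w ∈ T → C ⊨ w → _ → w ∈ u ∷ u′ ∷ restrict C′
        classify w∈T w⊨C (yes same) = ≡-twin⇒∈ (only-twins w∈T same)
        classify w∈T w⊨C (no differ) = there (there (∈-restrict⁺ w∈T (⊨-[]≔⁺ w⊨C (Bool.¬-not differ))))

      u⊭C′ : ¬ C′ ⊨ u
      u⊭C′ u⊨C′ = Bool.not-¬ refl (⊨-just u⊨C′ (lookup∘update i C (just b′)))

      split-Escapes : Escapes C′
      split-Escapes = u , u∈T , u⊭C′

      split-Witnessed : Escapes C → Witnessed C′
      split-Witnessed (z , z∈T , z⊭C) {j} {b} C′ⱼ≡b with j ≟ i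
      ... | yes refl = z , z∈T , z⊭C ∘ ⊨-[]≔⁻ Cᵢ≡- , trans zᵢ≡b′ b′≡b
        where
        b′≡b : b′ ≡ b
        b′≡b = just-injective (trans (sym (lookup∘update i C (just b′))) C′ⱼ≡b)
        zᵢ≡b′ : parity (lookup z i) ≡ b′
        zᵢ≡b′ = Bool.¬-not λ same → z⊭C (twin⇒⊨ (only-twins z∈T same))
      ... | no j≢i = u , u∈T , u⊭C′ , ⊨-just u⊨C (trans (sym (lookup∘update′ j≢i C (just b′))) C′ⱼ≡b)

  data Refinement (C : Constraint d) : Set where
    injective : length (restrict C) ≤ 2 ^ free C → Refinement C
    pinned    : length (restrict C) ≤ 2 → ¬ Witnessed C → Refinement C
    split     : ∀ C′ → free C ≡ suc (free C′) → length (restrict C) ≤ 2 + length (restrict C′) →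
                Escapes C′ → (Escapes C → Witnessed C′) → Refinement C

  refine : ∀ C → Refinement C
  refine C with Unique-parities⊎Twins C
  ... | inj₁ uniq = injective (length-restrict≤2^free C uniq)
  ... | inj₂ twins with lookup C (Twins.direction twins) in Cᵢ
  ...   | just _  = pinned (pinned-length≤2 twins Cᵢ) (pinned-¬Witnessed twins Cᵢ)
  ...   | nothing = split _ (split-free twins Cᵢ) (split-length twins Cᵢ)
                          (split-Escapes twins Cᵢ) (split-Witnessed twins Cᵢ)

  -- Witnessed C rules out the pinned case; for k ≥ 1 its bound 2 is below 2 ^ k + k anyway.
  escaping-bound : ∀ k C → free C ≡ k → Escapes C → Witnessed C ⊎ 1 ≤ k → length (restrict C) ≤ 2 ^ k + k
  escaping-bound k C free≡k _ _ with refine C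
  ... | injective ≤2^free = ≤-trans ≤2^free (≤-trans (≤-reflexive (cong (2 ^_) free≡k)) (m≤m+n _ k))
  escaping-bound k C _ _ (inj₁ witnessed) | pinned _ ¬witnessed = ⊥-elim (¬witnessed witnessed)
  escaping-bound (suc k) C _ _ (inj₂ _) | pinned ≤2 _ = ≤-trans ≤2 (≤-trans (2≤2^[1+n] k) (m≤m+n _ (suc k)))
  escaping-bound zero C free≡0 _ _ | split C′ free≡ _ _ _ = contradiction (trans (sym free≡0) free≡) 0≢1+n
  escaping-bound (suc k) C free≡k escapes _ | split C′ free≡ ≤2+ escapes′ witnessed′ = begin
    length (restrict C)      ≤⟨ ≤2+ ⟩
    2 + length (restrict C′) ≤⟨ +-monoʳ-≤ 2 (escaping-bound k C′ free′≡k escapes′ (inj₁ (witnessed′ escapes))) ⟩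
    2 + (2 ^ k + k)          ≤⟨ 2+[2^n+n]≤2^[1+n]+[1+n] k ⟩
    2 ^ suc k + suc k        ∎
    where
    open ≤-Reasoning
    free′≡k = suc-injective (trans (sym free≡) free≡k)

  general-bound : ∀ k C → free C ≡ 2 + k → length (restrict C) ≤ 2 ^ (2 + k) ⊔ (2 + (2 ^ suc k + suc k))
  general-bound k C free≡2+k with refine C
  ... | injective ≤2^free = ≤-trans ≤2^free (≤-trans (≤-reflexive (cong (2 ^_) free≡2+k)) (m≤m⊔n _ _))
  ... | pinned ≤2 _ = ≤-trans ≤2 (≤-trans (2≤2^[1+n] (suc k)) (m≤m⊔n _ _))
  ... | split C′ free≡ ≤2+ escapes′ _ = begin
    length (restrict C)                       ≤⟨ ≤2+ ⟩
    2 + length (restrict C′)                  ≤⟨ +-monoʳ-≤ 2 (escaping-bound (suc k) C′ free′≡1+k escapes′ (inj₂ (s≤s z≤n))) ⟩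
    2 + (2 ^ suc k + suc k)                   ≤⟨ m≤n⊔m _ _ ⟩
    2 ^ (2 + k) ⊔ (2 + (2 ^ suc k + suc k))   ∎
    where
    open ≤-Reasoning
    free′≡1+k = suc-injective (trans (sym free≡) free≡2+k)

independent-length≤ : ∀ k (S : List (Vertex (2 + k))) → IsIndependent S →
                      length S ≤ 2 ^ (2 + k) ⊔ (2 + (2 ^ suc k + suc k))
independent-length≤ k S indep = begin
  length S                                   ≤⟨ Unique-⊆⇒length≤ (proj₁ indep) S⊆restrict ⟩
  length (restrict (unconstrained (2 + k)))  ≤⟨ general-bound k _ (free-unconstrained (2 + k)) ⟩
  2 ^ (2 + k) ⊔ (2 + (2 ^ suc k + suc k))    ∎
  where
  open ≤-Reasoning
  open Refinement indep
  S⊆restrict : S ⊆ restrict (unconstrained (2 + k))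
  S⊆restrict w∈S = ∈-restrict⁺ w∈S ⊨-unconstrained

cube : ∀ d → List (Vertex d)
cube d = List.map (Vec.map bit) (completions (unconstrained d))

length-cube : ∀ d → length (cube d) ≡ 2 ^ d
length-cube d = trans (length-map _ (completions (unconstrained d)))
                      (trans (length-completions (unconstrained d)) (cong (2 ^_) (free-unconstrained d)))

cube-independent : ∀ d → IsIndependent (cube d)
cube-independent d = Unique.map⁺ map-bit-injective (Unique-completions (unconstrained d)) , nonadjacent
  where
  parities-bits : ∀ p → Vec.map parity (Vec.map bit p) ≡ p
  parities-bits p = trans (sym (map-∘ parity bit p)) (trans (map-cong parity-bit p) (map-id p))

  map-bit-injective : ∀ {p q : Vec Bool d} → Vec.map bit p ≡ Vec.map bit q → p ≡ q
  map-bit-injective {p} {q} eq =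
    trans (sym (parities-bits p)) (trans (cong (Vec.map parity) eq) (parities-bits q))

  nonadjacent : ∀ {u v} → u ∈ cube d → v ∈ cube d → ¬ Adjacent u v
  nonadjacent u∈ v∈ (_ , i , diff) with ∈-map⁻ _ u∈ | ∈-map⁻ _ v∈
  ... | p , _ , refl | q , _ , refl = antipode-bit≢bit (lookup p i) (lookup q i)
    (subst₂ (λ x y → antipode x ≡ y) (lookup-map i bit p) (lookup-map i bit q) (DiffTwo⇒antipode diff))

adjacent? : ∀ {d} (u v : Vertex d) → Dec (Adjacent u v)
adjacent? u v = (2 ≤? numDiff u v) ×-dec Fin.any? (λ i → (toℕ (lookup u i) + 2) % 4 ℕ.≟ toℕ (lookup v i))

five : List (Vertex 2)
five = (0F ∷ 0F ∷ []) ∷ (0F ∷ 1F ∷ []) ∷ (0F ∷ 2F ∷ []) ∷ (1F ∷ 1F ∷ []) ∷ (3F ∷ 1F ∷ []) ∷ []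

five-independent : IsIndependent five
five-independent =
  from-yes (allPairs? (λ u v → ¬? (≡-dec _≟_ u v)) five) ,
  λ u∈ v∈ → All.lookup (All.lookup pairwise-nonadjacent u∈) v∈
  where
  pairwise-nonadjacent : All.All (λ u → All.All (λ v → ¬ Adjacent u v) five) five
  pairwise-nonadjacent = from-yes (All.all? (λ u → All.all? (λ v → ¬? (adjacent? u v)) five) five)

theorem19 : ((d : ℕ) → 3 ≤ d → IndependenceNumber d (2 ^ d)) × IndependenceNumber 2 5
theorem19 = large , small
  where
  large : (d : ℕ) → 3 ≤ d → IndependenceNumber d (2 ^ d)
  large _ (s≤s (s≤s (s≤s {n = n} _))) =
    (cube (3 + n) , cube-independent (3 + n) , length-cube (3 + n)) ,
    λ S indep → ≤-trans (independent-length≤ (suc n) S indep) (⊔-lub ≤-refl (2+[2^[2+n]+[2+n]]≤2^[3+n] n))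

  small : IndependenceNumber 2 5
  small = (five , five-independent , refl) , independent-length≤ 0
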